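{- Given a Minsky machine program $P$ with $n$ registers, one can compute a program $Q$ with $1+n$ registers and no self loops such that for every $\vec v\in\mathbb N^n$, $$(1,P)\text{ terminates from }(1,\vec v)\iff(1,Q)\text{ terminates from }(1,0::\vec v).$$
   Context: An instruction over $n$ registers is $\mathrm{INC}\,\alpha$ or $\mathrm{DEC}\,\alpha\,p$ with $\alpha<n$ and $p\in\mathbb N$. A machine $(s,[\iota_0;\dots;\iota_k])$ has $\iota_j$ at label $s+j$. A state is $(i,\vec v)$ with $i\in\mathbb N$ and $\vec v\in\mathbb N^n$. If $i$ labels an instruction, one step is as follows. - $\mathrm{INC}\,\alpha$ goes to $(i+1,\vec v[\alpha\mapsto v_\alpha+1])$. - $\mathrm{DEC}\,\alpha\,p$ goes to $(i+1,\vec v[\alpha\mapsto v_\alpha-1])$ if $v_\alpha>0$, and to $(p,\vec v)$ if $v_\alpha=0$. No step is possible when the program counter is outside the code. A machine terminates from a state if, after finitely many steps, it reaches a state with program counter outside the code. A machine $(1,Q)$ has a self loop if some instruction at label $i$ is of the form $\mathrm{DEC}\,\alpha\,i$. -}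

module Defs where

open import Data.Nat using (ℕ; zero; suc; _<ᵇ_)
open import Data.Fin using (Fin)
open import Data.Vec using (Vec; lookup; _[_]≔_; _[_]%=_)
open import Data.List using (List; []; _∷_)
open import Data.Maybe using (Maybe; just; nothing)
open import Data.Bool using (if_then_else_)
open import Data.Product using (Σ; ∃; ∃-syntax; _×_; _,_)
open import Relation.Binary.PropositionalEquality using (_≡_)
open import Relation.Binary.Construct.Closure.ReflexiveTransitive using (Star)
open import Relation.Nullary using (¬_)
open import Data.Nat using (_∸_)

data Instr (n : ℕ) : Set where
  INC : Fin n → Instr n
  DEC : Fin n → ℕ → Instr n

-- A machine (s, [ι₀; …; ιₖ]) : ιⱼ sits at label s + j
record Machine (n : ℕ) : Set where
  constructor ⟨_,_⟩
  field
    start : ℕ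
    code  : List (Instr n)

nth : {A : Set} → List A → ℕ → Maybe A
nth []       _       = nothing
nth (x ∷ xs) zero    = just x
nth (x ∷ xs) (suc j) = nth xs j

instrAt : {n : ℕ} → Machine n → ℕ → Maybe (Instr n)
instrAt ⟨ s , Q ⟩ i = if i <ᵇ s then nothing else nth Q (i ∸ s)

State : ℕ → Set
State n = ℕ × Vec ℕ n

data Step {n : ℕ} (M : Machine n) : State n → State n → Set where
  inc  : ∀ {i v α} → instrAt M i ≡ just (INC α) →
         Step M (i , v) (suc i , v [ α ]%= suc)
  decS : ∀ {i v α p m} → instrAt M i ≡ just (DEC α p) → lookup v α ≡ suc m →
         Step M (i , v) (suc i , v [ α ]≔ m)
  decZ : ∀ {i v α p} → instrAt M i ≡ just (DEC α p) → lookup v α ≡ zero →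
         Step M (i , v) (p , v)

Halted : {n : ℕ} → Machine n → State n → Set
Halted M (i , v) = instrAt M i ≡ nothing

Terminates : {n : ℕ} → Machine n → State n → Set
Terminates M c = ∃[ c' ] (Star (Step M) c c' × Halted M c')

HasSelfLoop : {n : ℕ} → Machine n → Set
HasSelfLoop M = ∃[ i ] ∃[ α ] (instrAt M i ≡ just (DEC α i))

-- Register 0 is never incremented, so a DEC on it is an unconditional jump. The compiled program
-- runs P in lockstep with register 0 at zero. A DEC α i at label i only takes its zero branch when
-- the machine would spin on that state forever, so that branch is sent into a two-label cycle of
-- such jumps instead; jumps leaving P's code go to label 0, and falling off the end of P hits a
-- jump to 0. Hence both machines halt on exactly the same inputs, and Q has no self loop.
module Submission where

open import Defs
open import Data.Nat using (ℕ; zero; suc; pred; _+_; _≤_; _<_; _≟_; _≤?_; z≤n; s≤s)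
open import Data.Nat.Properties
  using (≤-antisym; ≤-trans; +-suc; <-≤-trans; <⇒≢; ≰⇒>; m≤m+n; n≤1+n; +-identityʳ; +-cancelˡ-≡; m≤n⇒∃[o]m+o≡n)
open import Data.Fin using (Fin) renaming (zero to fzero; suc to fsuc)
open import Data.List using (List; []; _∷_; length; _++_)
open import Data.Vec using (Vec; _∷_; lookup)
open import Data.Maybe using (just; nothing)
open import Data.Product using (Σ; ∃; _×_; _,_; proj₂)
open import Data.Empty using (⊥; ⊥-elim)
open import Relation.Nullary using (¬_; yes; no)
open import Relation.Binary.PropositionalEquality
  using (_≡_; _≢_; refl; sym; trans; cong; subst)
open import Relation.Binary.Construct.Closure.ReflexiveTransitive using (Star; ε; _◅_)
open import Function.Bundles using (_⇔_; mk⇔)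

module _ {n : ℕ} (M : Machine n) where

  Step-deterministic : ∀ {c c₁ c₂} → Step M c c₁ → Step M c c₂ → c₁ ≡ c₂
  Step-deterministic (inc e) (inc e') with trans (sym e) e'
  ... | refl = refl
  Step-deterministic (inc e) (decS e' _) with trans (sym e) e'
  ... | ()
  Step-deterministic (inc e) (decZ e' _) with trans (sym e) e'
  ... | ()
  Step-deterministic (decS e _) (inc e') with trans (sym e) e'
  ... | ()
  Step-deterministic (decS e z) (decS e' z') with trans (sym e) e'
  ... | refl with trans (sym z) z'
  ...   | refl = refl
  Step-deterministic (decS e z) (decZ e' z') with trans (sym e) e'
  ... | refl with trans (sym z) z'
  ...   | ()
  Step-deterministic (decZ e _) (inc e') with trans (sym e) e'
  ... | ()
  Step-deterministic (decZ e z) (decS e' z') with trans (sym e) e'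
  ... | refl with trans (sym z) z'
  ...   | ()
  Step-deterministic (decZ e _) (decZ e' _) with trans (sym e) e'
  ... | refl = refl

  Step-progress : ∀ {i v ι} → instrAt M i ≡ just ι → ∃ λ c → Step M (i , v) c
  Step-progress {ι = INC α} e = _ , inc e
  Step-progress {v = v} {ι = DEC α p} e with lookup v α in z
  ... | zero  = _ , decZ e z
  ... | suc m = _ , decS e z

  Step⇒¬Halted : ∀ {c c₁} → Step M c c₁ → ¬ Halted M c
  Step⇒¬Halted (inc e)    h with trans (sym e) h
  ... | ()
  Step⇒¬Halted (decS e _) h with trans (sym e) h
  ... | ()
  Step⇒¬Halted (decZ e _) h with trans (sym e) h
  ... | ()

  Terminates-◅ : ∀ {c c₁} → Step M c c₁ → Terminates M c₁ → Terminates M c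
  Terminates-◅ s (c' , run , h) = c' , s ◅ run , h

  two-cycle-¬Terminates : ∀ {a b α v} → instrAt M a ≡ just (DEC α b) → instrAt M b ≡ just (DEC α a) →
                          lookup v α ≡ 0 → ¬ Terminates M (a , v)
  two-cycle-¬Terminates {α = α} {v} ea eb z (_ , run , h) = cycle ea eb run h
    where
      cycle : ∀ {a b c} → instrAt M a ≡ just (DEC α b) → instrAt M b ≡ just (DEC α a) →
              Star (Step M) (a , v) c → Halted M c → ⊥
      cycle {a} ea eb ε h = Step⇒¬Halted (decZ {i = a} {v} ea z) h
      cycle {a} ea eb (s ◅ run) h with Step-deterministic s (decZ {i = a} ea z)
      ... | refl = cycle eb ea run h

module _ {A : Set} where

  nth-just⇒< : ∀ (xs : List A) {j x} → nth xs j ≡ just x → j < length xs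
  nth-just⇒< (_ ∷ xs) {zero}  e = s≤s z≤n
  nth-just⇒< (_ ∷ xs) {suc j} e = s≤s (nth-just⇒< xs e)

  nth-nothing⇒≥ : ∀ (xs : List A) {j} → nth xs j ≡ nothing → length xs ≤ j
  nth-nothing⇒≥ []       e = z≤n
  nth-nothing⇒≥ (_ ∷ xs) {zero}  ()
  nth-nothing⇒≥ (_ ∷ xs) {suc j} e = s≤s (nth-nothing⇒≥ xs e)

  ≥⇒nth-nothing : ∀ (xs : List A) {j} → length xs ≤ j → nth xs j ≡ nothing
  ≥⇒nth-nothing []       le = refl
  ≥⇒nth-nothing (_ ∷ xs) (s≤s le) = ≥⇒nth-nothing xs le

  nth-++ˡ : ∀ (xs ys : List A) {j x} → nth xs j ≡ just x → nth (xs ++ ys) j ≡ just x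
  nth-++ˡ (_ ∷ xs) ys {zero}  e = e
  nth-++ˡ (_ ∷ xs) ys {suc j} e = nth-++ˡ xs ys e

  nth-++-length : ∀ (xs ys : List A) d → nth (xs ++ ys) (length xs + d) ≡ nth ys d
  nth-++-length []       ys d = refl
  nth-++-length (_ ∷ xs) ys d = nth-++-length xs ys d

DEC-target-injective : ∀ {m} {α β : Fin m} {p q} → just (DEC α p) ≡ just (DEC β q) → p ≡ q
DEC-target-injective refl = refl

module Compile {n : ℕ} (P : List (Instr n)) where

  exit : ℕ
  exit = suc (length P)

  redirect : ℕ → ℕ → ℕ
  redirect i p with p ≟ i
  ... | yes _ = exit + 1
  ... | no _ with p ≤? exit
  ...   | yes _ = p
  ...   | no _  = 0

  translate : ℕ → Instr n → Instr (suc n)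
  translate i (INC α)   = INC (fsuc α)
  translate i (DEC α p) = DEC (fsuc α) (redirect i p)

  translateFrom : ℕ → List (Instr n) → List (Instr (suc n))
  translateFrom k []       = []
  translateFrom k (ι ∷ ιs) = translate k ι ∷ translateFrom (suc k) ιs

  gadget : List (Instr (suc n))
  gadget = DEC fzero 0 ∷ DEC fzero (exit + 2) ∷ DEC fzero (exit + 1) ∷ []

  compiled : List (Instr (suc n))
  compiled = translateFrom 1 P ++ gadget

  MP : Machine n
  MP = ⟨ 1 , P ⟩

  MQ : Machine (suc n)
  MQ = ⟨ 1 , compiled ⟩

  length-translateFrom : ∀ k (ιs : List (Instr n)) → length (translateFrom k ιs) ≡ length ιs
  length-translateFrom k []       = refl
  length-translateFrom k (_ ∷ ιs) = cong suc (length-translateFrom (suc k) ιs)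

  nth-translateFrom : ∀ k (ιs : List (Instr n)) {j ι} → nth ιs j ≡ just ι →
                      nth (translateFrom k ιs) j ≡ just (translate (k + j) ι)
  nth-translateFrom k (_ ∷ ιs) {zero} refl rewrite +-identityʳ k = refl
  nth-translateFrom k (_ ∷ ιs) {suc j} e rewrite +-suc k j = nth-translateFrom (suc k) ιs e

  instrAt-compiled : ∀ i {ι} → instrAt MP i ≡ just ι → instrAt MQ i ≡ just (translate i ι)
  instrAt-compiled (suc j) e = nth-++ˡ (translateFrom 1 P) gadget (nth-translateFrom 1 P e)

  instrAt-gadget : ∀ d → instrAt MQ (exit + d) ≡ nth gadget d
  instrAt-gadget d =
    subst (λ k → nth compiled (k + d) ≡ nth gadget d) (length-translateFrom 1 P)
          (nth-++-length (translateFrom 1 P) gadget d)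

  instrAt-exit : instrAt MQ exit ≡ just (DEC fzero 0)
  instrAt-exit = subst (λ k → instrAt MQ k ≡ just (DEC fzero 0)) (+-identityʳ exit) (instrAt-gadget 0)

  instrAt-just⇒≤ : ∀ i {ι} → instrAt MP i ≡ just ι → i ≤ length P
  instrAt-just⇒≤ (suc j) e = nth-just⇒< P e

  instrAt-beyond-exit : ∀ {p} → exit < p → instrAt MP p ≡ nothing
  instrAt-beyond-exit {suc j} (s≤s lt) = ≥⇒nth-nothing P (≤-trans (n≤1+n _) lt)

  -- Tracks c d j: the label j reached by the compiled machine when P steps from c to d.
  data Tracks (c : State n) : State n → ℕ → Set where
    same   : ∀ {j w} → j ≤ exit → Tracks c (j , w) j
    stay   : Tracks c c (exit + 1)
    escape : ∀ {j w} → instrAt MP j ≡ nothing → Tracks c (j , w) 0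

  redirect-tracks : ∀ i p {v} → Tracks (i , v) (p , v) (redirect i p)
  redirect-tracks i p with p ≟ i
  ... | yes refl = stay
  ... | no _ with p ≤? exit
  ...   | yes le = same le
  ...   | no gt  = escape (instrAt-beyond-exit (≰⇒> gt))

  simulate : ∀ {i v c} → Step MP (i , v) c →
             Σ ℕ λ j → Step MQ (i , 0 ∷ v) (j , 0 ∷ proj₂ c) × Tracks (i , v) c j
  simulate {i} (inc e)    = _ , inc (instrAt-compiled i e) , same (s≤s (instrAt-just⇒≤ i e))
  simulate {i} (decS e z) = _ , decS (instrAt-compiled i e) z , same (s≤s (instrAt-just⇒≤ i e))
  simulate {i} (decZ {p = p} e z) = redirect i p , decZ (instrAt-compiled i e) z , redirect-tracks i p

  loop-¬Terminates : ∀ {v} → ¬ Terminates MQ (exit + 1 , 0 ∷ v)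
  loop-¬Terminates = two-cycle-¬Terminates MQ (instrAt-gadget 1) (instrAt-gadget 2) refl

  halted-terminates : ∀ {i v} → instrAt MP i ≡ nothing → i ≤ exit → Terminates MQ (i , 0 ∷ v)
  halted-terminates {zero}  h le = _ , ε , refl
  halted-terminates {suc j} h (s≤s le) rewrite ≤-antisym le (nth-nothing⇒≥ P h) =
    Terminates-◅ MQ (decZ instrAt-exit refl) (_ , ε , refl)

  terminates-forward : ∀ {i v c'} → Star (Step MP) (i , v) c' → Halted MP c' → i ≤ exit →
                       Terminates MQ (i , 0 ∷ v)
  terminates-forward ε h le = halted-terminates h le
  terminates-forward (s ◅ run) h le with simulate s
  ... | _ , sQ , same le' = Terminates-◅ MQ sQ (terminates-forward run h le')
  ... | _ , _  , stay     = terminates-forward run h le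
  ... | _ , sQ , escape _ = Terminates-◅ MQ sQ (_ , ε , refl)

  terminates-backward : ∀ {c c'} → Star (Step MQ) c c' → Halted MQ c' →
                        ∀ {i v} → c ≡ (i , 0 ∷ v) → Terminates MP (i , v)
  terminates-backward run h {i} refl with instrAt MP i in e
  ... | nothing = _ , ε , e
  ... | just _ with Step-progress MP e
  ...   | _ , sP with simulate sP | run
  ...     | _ , sQ , _ | ε = ⊥-elim (Step⇒¬Halted MQ sQ h)
  ...     | _ , sQ , t | s ◅ run' with Step-deterministic MQ s sQ
  ...       | refl with t
  ...         | same _    = Terminates-◅ MP sP (terminates-backward run' h refl)
  ...         | stay      = ⊥-elim (loop-¬Terminates (_ , run' , h))
  ...         | escape e' = Terminates-◅ MP sP (_ , ε , e')

  redirect-≢ : ∀ {j} p → j < length P → redirect (suc j) p ≢ suc j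
  redirect-≢ {j} p lt with p ≟ suc j
  ... | yes _ = λ eq → <⇒≢ (<-≤-trans lt (m≤m+n (length P) 1)) (sym (cong pred eq))
  ... | no p≢ with p ≤? exit
  ...   | yes _ = p≢
  ...   | no _  = λ ()

  gadget-no-self-loop : ∀ {α} d → nth gadget d ≢ just (DEC α (exit + d))
  gadget-no-self-loop 0 ()
  gadget-no-self-loop 1 eq with +-cancelˡ-≡ exit _ _ (DEC-target-injective eq)
  ... | ()
  gadget-no-self-loop 2 eq with +-cancelˡ-≡ exit _ _ (DEC-target-injective eq)
  ... | ()
  gadget-no-self-loop (suc (suc (suc d))) ()

  compiled-no-self-loop : ¬ HasSelfLoop MQ
  compiled-no-self-loop (suc j , α , e) with instrAt MP (suc j) in eP
  ... | just (INC β)   with trans (sym (instrAt-compiled (suc j) eP)) e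
  ...   | ()
  compiled-no-self-loop (suc j , α , e) | just (DEC β p) =
    redirect-≢ p (nth-just⇒< P eP) (DEC-target-injective (trans (sym (instrAt-compiled (suc j) eP)) e))
  compiled-no-self-loop (suc j , α , e) | nothing with m≤n⇒∃[o]m+o≡n (nth-nothing⇒≥ P eP)
  ... | d , refl = gadget-no-self-loop d (trans (sym (instrAt-gadget d)) e)

theorem6p1 : (n : ℕ) →
    Σ (List (Instr n) → List (Instr (suc n))) λ f →
      (P : List (Instr n)) →
        ¬ HasSelfLoop ⟨ 1 , f P ⟩ ×
        ((v : Vec ℕ n) → Terminates ⟨ 1 , P ⟩ (1 , v) ⇔ Terminates ⟨ 1 , f P ⟩ (1 , 0 ∷ v))
theorem6p1 n = Compile.compiled , λ P → let open Compile P in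
  compiled-no-self-loop , λ v →
    mk⇔ (λ (_ , run , h) → terminates-forward run h (s≤s z≤n))
        (λ (_ , run , h) → terminates-backward run h refl)
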